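{- Let $P\subset V$ be a $d$-dimensional rational polytope, $0\le k\le d$, and $\Lambda_P:=\mathrm{aff}(P)\cap\Lambda$. (i) If one of the $k$-dimensional faces of $P$ is affinely integral, then $\pi^{(D-k)}(\Lambda_P)=\Lambda_k$. (ii) If $P$ is central and one of the $k$-dimensional faces of $P$ is in affinely general position, then $\pi^{(D-k)}(\Lambda_P)$ has rank $k$ and $\Lambda^k\cap\Lambda_P$ has rank $d-k$.
   Context: $V$ is a real vector space of dimension $D$, $\Lambda\subset V$ a lattice with fixed basis $\mathfrak{e}=(\mathbf{e}^1,\dots,\mathbf{e}^D)$ giving coordinates; a rational polytope has vertices with rational coordinates. $V_j=\mathrm{span}(\mathbf{e}^1,\dots,\mathbf{e}^j)$, $\Lambda_j=\langle\mathbf{e}^1,\dots,\mathbf{e}^j\rangle$, $\Lambda^k=\langle\mathbf{e}^{k+1},\dots,\mathbf{e}^D\rangle$. $\pi^{(D-j)}:V\to V_j$ forgets the last $D-j$ coordinates. A polytope is central if its affine hull contains the origin. An $r$-dimensional affine subspace $U$ is integral if $\pi^{(D-r)}(U\cap\Lambda)=\Lambda_r$ and in general position if $\pi^{(D-r)}(U)=V_r$; a polytope is affinely integral / in affinely general position if its affine hull is. A subgroup $\Gamma$ of $\Lambda$ (or of its images) has rank $r$ if its affine hull has dimension $r$.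
   Formalization: The space V is taken as ℚ^D in place of a real vector space of dimension D, so affine hulls, faces and general position of P are taken over the rationals. -}

module Defs where

open import Data.Nat using (ℕ; zero; suc; _≤_)
open import Data.Integer using (ℤ)
open import Data.Rational using (ℚ; _+_; _*_; 0ℚ; 1ℚ; _/_)
import Data.Rational as Q
open import Data.Fin using (Fin; inject≤)
import Data.Fin as F
open import Data.Product using (Σ; ∃; _×_)
open import Relation.Nullary using (¬_)
open import Relation.Binary.PropositionalEquality using (_≡_)

Point : ℕ → Set
Point D = Fin D → ℚ

PSet : ℕ → Set₁
PSet D = Point D → Set

_≐_ : ∀ {D} → Point D → Point D → Set
x ≐ y = ∀ i → x i ≡ y i

Σℚ : ∀ {n} → (Fin n → ℚ) → ℚ
Σℚ {zero} f = 0ℚ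
Σℚ {suc n} f = f F.zero + Σℚ (λ i → f (F.suc i))

lincomb : ∀ {n D} → (Fin n → ℚ) → (Fin n → Point D) → Point D
lincomb λs p j = Σℚ (λ i → λs i * p i j)

_·_ : ∀ {D} → Point D → Point D → ℚ
c · x = Σℚ (λ i → c i * x i)

zeroPt : ∀ {D} → Point D
zeroPt _ = 0ℚ

AllIn : ∀ {n D} → PSet D → (Fin n → Point D) → Set
AllIn A p = ∀ i → A (p i)

aff : ∀ {D} → PSet D → PSet D
aff {D} A x = ∃ λ (n : ℕ) → Σ (Fin n → Point D) λ p → Σ (Fin n → ℚ) λ λs →
  AllIn A p × Σℚ λs ≡ 1ℚ × (x ≐ lincomb λs p)

conv : ∀ {m D} → (Fin m → Point D) → PSet D
conv {m} v x = Σ (Fin m → ℚ) λ λs →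
  (∀ i → 0ℚ Q.≤ λs i) × Σℚ λs ≡ 1ℚ × (x ≐ lincomb λs v)

AffIndep : ∀ {n D} → (Fin n → Point D) → Set
AffIndep {n} p = ∀ (λs : Fin n → ℚ) → Σℚ λs ≡ 0ℚ → lincomb λs p ≐ zeroPt →
  ∀ i → λs i ≡ 0ℚ

AffDim : ∀ {D} → PSet D → ℕ → Set
AffDim {D} A r =
  (Σ (Fin (suc r) → Point D) λ p → AllIn A p × AffIndep p) ×
  (∀ (q : Fin (suc (suc r)) → Point D) → AllIn A q → ¬ AffIndep q)

-- a subgroup (or any subset) has rank r if its affine hull has dimension r
Rank : ∀ {D} → PSet D → ℕ → Set
Rank = AffDim

ι : ℤ → ℚ
ι z = z / 1

-- the lattice Λ = ℤ^D (integer coordinates w.r.t. 𝔢)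
Lattice : ∀ {D} → PSet D
Lattice x = ∀ i → ∃ λ (z : ℤ) → x i ≡ ι z

_∩_ : ∀ {D} → PSet D → PSet D → PSet D
(A ∩ B) x = A x × B x

Img : ∀ {D E} → (Point D → Point E) → PSet D → PSet E
Img f A y = ∃ λ x → A x × (f x ≐ y)

_≋_ : ∀ {D} → PSet D → PSet D → Set
A ≋ B = (∀ x → A x → B x) × (∀ x → B x → A x)

-- π^{(D-r)} : V → V_r, forgetting the last D-r coordinates
proj : ∀ {D} r → r ≤ D → Point D → Point r
proj r r≤D x i = x (inject≤ i r≤D)

-- Λ^k = ⟨e^{k+1},…,e^D⟩ : lattice points whose first k coordinates vanish
UpperLattice : ∀ {D} k → k ≤ D → PSet D
UpperLattice k k≤D x = Lattice x × (proj k k≤D x ≐ zeroPt)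

Integral : ∀ {D} r → r ≤ D → PSet D → Set
Integral r r≤D U = Img (proj r r≤D) (U ∩ Lattice) ≋ Lattice

GenPos : ∀ {D} r → r ≤ D → PSet D → Set
GenPos r r≤D U = ∀ (y : Point r) → Img (proj r r≤D) U y

IsFace : ∀ {D} → PSet D → PSet D → Set
IsFace {D} P F = Σ (Point D) λ c → Σ ℚ λ b →
  (∀ x → P x → (c · x) Q.≤ b) × (F ≋ (λ x → P x × (c · x) ≡ b))

Central : ∀ {D} → PSet D → Set
Central P = aff P zeroPt

module Submission where

-- Part (i) is monotonicity: a face F lies in P, so aff F ⊆ aff P, and the lattice
-- points of aff F already project onto Λₖ (projected-lattice).
--
-- Because P is central, aff P is the linear
-- span L of the edges b = (p₁ - p₀, …, p_d - p₀) of a maximal affinely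
-- independent family p in P (aff⇒affComb, OriginIn).  General position of a
-- k-face gives y₁, …, yₖ ∈ L with π yᵢ = eᵢ.  Lattice multiples of the yᵢ show
-- that π(L ∩ Λ) has rank k; the residuals x - Σᵢ xᵢ yᵢ of the edges span
-- L ∩ ker π, which has dimension d - k by Steinitz exchange (ProjectionRanks).

open import Defs
open import Data.Nat using (ℕ; suc; _≤_; _∸_)
open import Data.Fin using (Fin)
open import Data.Product using (Σ; _×_)

open import Data.Nat using (zero; _<_; s≤s)
import Data.Nat as ℕ
import Data.Nat.Properties as ℕP
open import Data.Integer using (ℤ)
import Data.Integer as ℤ
import Data.Integer.Properties as ℤP
import Data.Integer.GCD as ℤGCD
open import Data.Fin using (punchIn; _↑ˡ_; _↑ʳ_; inject≤; splitAt; join)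
import Data.Fin as F
import Data.Fin.Properties as FP
open import Data.Vec.Functional using (_∷_; _++_; tail; insertAt)
open import Data.Vec.Functional.Properties
  using (insertAt-lookup; insertAt-punchIn; lookup-++ˡ; lookup-++ʳ)
open import Data.Rational using (ℚ; _+_; _*_; -_; _-_; 0ℚ; 1ℚ; 1/_; ↥_; ↧_)
import Data.Rational as Q
import Data.Rational.Properties as QP
import Data.Rational.Unnormalised as U
import Data.Rational.Unnormalised.Properties as UP
open import Data.Rational.Solver using (module +-*-Solver)
open +-*-Solver using (solve; _:+_; _:*_; _:-_; :-_; _:=_)
open import Data.Product using (∃; _,_; proj₁; proj₂)
open import Data.Sum using (_⊎_; inj₁; inj₂)
import Data.Sum as Sum
open import Data.Empty using (⊥; ⊥-elim)
open import Relation.Nullary using (¬_; yes; no; ¬?)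
open import Relation.Nullary.Decidable using (decidable-stable)
open import Relation.Binary.PropositionalEquality
open ≡-Reasoning

Σ-cong : ∀ {n} {f g : Fin n → ℚ} → (∀ i → f i ≡ g i) → Σℚ f ≡ Σℚ g
Σ-cong {zero} h = refl
Σ-cong {suc n} h = cong₂ _+_ (h F.zero) (Σ-cong (λ i → h (F.suc i)))

Σ-zero : ∀ {n} {f : Fin n → ℚ} → (∀ i → f i ≡ 0ℚ) → Σℚ f ≡ 0ℚ
Σ-zero {zero} h = refl
Σ-zero {suc n} h = trans (cong₂ _+_ (h F.zero) (Σ-zero (λ i → h (F.suc i)))) (QP.+-identityˡ 0ℚ)

Σ-*-zeroˡ : ∀ {n} {f g : Fin n → ℚ} → (∀ i → f i ≡ 0ℚ) → Σℚ (λ i → f i * g i) ≡ 0ℚ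
Σ-*-zeroˡ {g = g} h = Σ-zero (λ i → trans (cong (_* g i) (h i)) (QP.*-zeroˡ (g i)))

Σ-*-zeroʳ : ∀ {n} {f g : Fin n → ℚ} → (∀ i → g i ≡ 0ℚ) → Σℚ (λ i → f i * g i) ≡ 0ℚ
Σ-*-zeroʳ {f = f} h = Σ-zero (λ i → trans (cong (f i *_) (h i)) (QP.*-zeroʳ (f i)))

Σ-+ : ∀ {n} (f g : Fin n → ℚ) → Σℚ (λ i → f i + g i) ≡ Σℚ f + Σℚ g
Σ-+ {zero} f g = refl
Σ-+ {suc n} f g rewrite Σ-+ (λ i → f (F.suc i)) (λ i → g (F.suc i)) =
  solve 4 (λ a b c d → (a :+ b) :+ (c :+ d) := (a :+ c) :+ (b :+ d)) refl
    (f F.zero) (g F.zero) (Σℚ (λ i → f (F.suc i))) (Σℚ (λ i → g (F.suc i)))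

Σ-*ˡ : ∀ {n} (c : ℚ) (f : Fin n → ℚ) → Σℚ (λ i → c * f i) ≡ c * Σℚ f
Σ-*ˡ {zero} c f = sym (QP.*-zeroʳ c)
Σ-*ˡ {suc n} c f rewrite Σ-*ˡ c (λ i → f (F.suc i)) = sym (QP.*-distribˡ-+ c _ _)

Σ-*ʳ : ∀ {n} (c : ℚ) (f : Fin n → ℚ) → Σℚ (λ i → f i * c) ≡ Σℚ f * c
Σ-*ʳ c f = trans (Σ-cong (λ i → QP.*-comm (f i) c)) (trans (Σ-*ˡ c f) (QP.*-comm c _))

Σ-neg : ∀ {n} (f : Fin n → ℚ) → Σℚ (λ i → - f i) ≡ - Σℚ f
Σ-neg {zero} f = refl
Σ-neg {suc n} f rewrite Σ-neg (λ i → f (F.suc i)) = sym (QP.neg-distrib-+ (f F.zero) _)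

Σ-- : ∀ {n} (f g : Fin n → ℚ) → Σℚ (λ i → f i - g i) ≡ Σℚ f - Σℚ g
Σ-- f g = trans (Σ-+ f (λ i → - g i)) (cong (Σℚ f +_) (Σ-neg g))

Σ-swap : ∀ {n m} (f : Fin n → Fin m → ℚ) →
  Σℚ (λ i → Σℚ (λ j → f i j)) ≡ Σℚ (λ j → Σℚ (λ i → f i j))
Σ-swap {zero} {m} f = sym (Σ-zero {m} (λ _ → refl))
Σ-swap {suc n} f = begin
    Σℚ (λ j → f F.zero j) + Σℚ (λ i → Σℚ (λ j → f (F.suc i) j))
      ≡⟨ cong (Σℚ (λ j → f F.zero j) +_) (Σ-swap (λ i j → f (F.suc i) j)) ⟩
    Σℚ (λ j → f F.zero j) + Σℚ (λ j → Σℚ (λ i → f (F.suc i) j))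
      ≡⟨ Σ-+ (λ j → f F.zero j) (λ j → Σℚ (λ i → f (F.suc i) j)) ⟨
    Σℚ (λ j → f F.zero j + Σℚ (λ i → f (F.suc i) j)) ∎

Σ-punchIn : ∀ {n} (i : Fin (suc n)) (f : Fin (suc n) → ℚ) →
  Σℚ f ≡ f i + Σℚ (λ j → f (punchIn i j))
Σ-punchIn F.zero f = refl
Σ-punchIn {suc n} (F.suc i) f rewrite Σ-punchIn i (λ j → f (F.suc j)) =
  solve 3 (λ a b c → a :+ (b :+ c) := b :+ (a :+ c)) refl
    (f F.zero) (f (F.suc i)) (Σℚ (λ j → f (F.suc (punchIn i j))))

Σ-split : ∀ m {n} (f : Fin (m ℕ.+ n) → ℚ) →
  Σℚ f ≡ Σℚ (λ i → f (i ↑ˡ n)) + Σℚ (λ j → f (m ↑ʳ j))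
Σ-split zero f = sym (QP.+-identityˡ _)
Σ-split (suc m) f rewrite Σ-split m (λ i → f (F.suc i)) = sym (QP.+-assoc (f F.zero) _ _)

unit : ∀ {n} → Fin n → Point n
unit F.zero    F.zero    = 1ℚ
unit F.zero    (F.suc i) = 0ℚ
unit (F.suc j) F.zero    = 0ℚ
unit (F.suc j) (F.suc i) = unit j i

unit-sym : ∀ {n} (i j : Fin n) → unit i j ≡ unit j i
unit-sym F.zero    F.zero    = refl
unit-sym F.zero    (F.suc j) = refl
unit-sym (F.suc i) F.zero    = refl
unit-sym (F.suc i) (F.suc j) = unit-sym i j

Σ-unit : ∀ {n} (j : Fin n) (f : Fin n → ℚ) → Σℚ (λ i → unit j i * f i) ≡ f j
Σ-unit F.zero f = begin
    1ℚ * f F.zero + Σℚ (λ i → 0ℚ * f (F.suc i))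
      ≡⟨ cong₂ _+_ (QP.*-identityˡ (f F.zero)) (Σ-*-zeroˡ {f = λ _ → 0ℚ} {g = λ i → f (F.suc i)} (λ _ → refl)) ⟩
    f F.zero + 0ℚ ≡⟨ QP.+-identityʳ (f F.zero) ⟩
    f F.zero ∎
Σ-unit (F.suc j) f = begin
    0ℚ * f F.zero + Σℚ (λ i → unit j i * f (F.suc i))
      ≡⟨ cong (_+ Σℚ (λ i → unit j i * f (F.suc i))) (QP.*-zeroˡ (f F.zero)) ⟩
    0ℚ + Σℚ (λ i → unit j i * f (F.suc i))
      ≡⟨ QP.+-identityˡ _ ⟩
    Σℚ (λ i → unit j i * f (F.suc i))
      ≡⟨ Σ-unit j (λ i → f (F.suc i)) ⟩
    f (F.suc j) ∎

lincomb-+ : ∀ {n D} (c d : Fin n → ℚ) (w : Fin n → Point D) t →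
  lincomb (λ i → c i + d i) w t ≡ lincomb c w t + lincomb d w t
lincomb-+ c d w t = trans (Σ-cong (λ i → QP.*-distribʳ-+ (w i t) (c i) (d i)))
  (Σ-+ (λ i → c i * w i t) (λ i → d i * w i t))

lincomb-- : ∀ {n D} (c d : Fin n → ℚ) (w : Fin n → Point D) t →
  lincomb (λ i → c i - d i) w t ≡ lincomb c w t - lincomb d w t
lincomb-- c d w t = trans
  (Σ-cong (λ i → solve 3 (λ c d w → (c :- d) :* w := c :* w :- d :* w) refl (c i) (d i) (w i t)))
  (Σ-- (λ i → c i * w i t) (λ i → d i * w i t))

lincomb-comp : ∀ {n s D} (c : Fin n → ℚ) (a : Fin n → Fin s → ℚ) (u : Fin s → Point D) t →
  lincomb c (λ l → lincomb (a l) u) t ≡ lincomb (λ i → Σℚ (λ l → c l * a l i)) u t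
lincomb-comp c a u t = begin
    Σℚ (λ l → c l * Σℚ (λ i → a l i * u i t))
      ≡⟨ Σ-cong (λ l → sym (Σ-*ˡ (c l) (λ i → a l i * u i t))) ⟩
    Σℚ (λ l → Σℚ (λ i → c l * (a l i * u i t)))
      ≡⟨ Σ-swap (λ l i → c l * (a l i * u i t)) ⟩
    Σℚ (λ i → Σℚ (λ l → c l * (a l i * u i t)))
      ≡⟨ Σ-cong (λ i → trans (Σ-cong (λ l → sym (QP.*-assoc (c l) (a l i) (u i t))))
                              (Σ-*ʳ (u i t) (λ l → c l * a l i))) ⟩
    Σℚ (λ i → Σℚ (λ l → c l * a l i) * u i t) ∎

lincomb-split : ∀ {a k D} (c : Fin (a ℕ.+ k) → ℚ) (w : Fin (a ℕ.+ k) → Point D) t →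
  lincomb c w t ≡ lincomb (λ i → c (i ↑ˡ k)) (λ i → w (i ↑ˡ k)) t
                    + lincomb (λ j → c (a ↑ʳ j)) (λ j → w (a ↑ʳ j)) t
lincomb-split {a} c w t = Σ-split a (λ i → c i * w i t)

lincomb-++ : ∀ {a k D} (c : Fin (a ℕ.+ k) → ℚ) (f : Fin a → Point D) (g : Fin k → Point D) t →
  lincomb c (f ++ g) t ≡ lincomb (λ i → c (i ↑ˡ k)) f t + lincomb (λ j → c (a ↑ʳ j)) g t
lincomb-++ {a} {k} c f g t = trans (lincomb-split {a} {k} c (f ++ g) t)
  (cong₂ _+_ (Σ-cong (λ i → cong (λ w → c (i ↑ˡ k) * w t) (lookup-++ˡ f g i)))
             (Σ-cong (λ j → cong (λ w → c (a ↑ʳ j) * w t) (lookup-++ʳ f g j))))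

all-++ : ∀ {a k D} (P : Point D → Set) (f : Fin a → Point D) (g : Fin k → Point D) →
  (∀ i → P (f i)) → (∀ j → P (g j)) → ∀ x → P ((f ++ g) x)
all-++ {a} P f g Pf Pg x = by-block (splitAt a x)
  where
  by-block : ∀ s → P (Sum.[ f , g ]′ s)
  by-block (inj₁ i) = Pf i
  by-block (inj₂ j) = Pg j

dot-lincomb : ∀ {n D} (g : Point D) (c : Fin n → ℚ) (w : Fin n → Point D) →
  g · lincomb c w ≡ Σℚ (λ i → c i * (g · w i))
dot-lincomb g c w = begin
    Σℚ (λ t → g t * Σℚ (λ i → c i * w i t))
      ≡⟨ Σ-cong (λ t → sym (Σ-*ˡ (g t) (λ i → c i * w i t))) ⟩
    Σℚ (λ t → Σℚ (λ i → g t * (c i * w i t)))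
      ≡⟨ Σ-swap (λ t i → g t * (c i * w i t)) ⟩
    Σℚ (λ i → Σℚ (λ t → g t * (c i * w i t)))
      ≡⟨ Σ-cong (λ i → trans
           (Σ-cong (λ t → solve 3 (λ g c w → g :* (c :* w) := c :* (g :* w)) refl (g t) (c i) (w i t)))
           (Σ-*ˡ (c i) (λ t → g t * w i t))) ⟩
    Σℚ (λ i → c i * (g · w i)) ∎

dot-zero : ∀ {D} (g x : Point D) → x ≐ zeroPt → g · x ≡ 0ℚ
dot-zero g x h = Σ-*-zeroʳ {f = g} h

inv : (a : ℚ) → ¬ a ≡ 0ℚ → ℚ
inv a a≢0 = 1/_ a {{Q.≢-nonZero a≢0}}

inv-l : (a : ℚ) (a≢0 : ¬ a ≡ 0ℚ) → inv a a≢0 * a ≡ 1ℚ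
inv-l a a≢0 = QP.*-inverseˡ a {{Q.≢-nonZero a≢0}}

*-cancelˡ-≢0 : (a b : ℚ) → ¬ a ≡ 0ℚ → a * b ≡ 0ℚ → b ≡ 0ℚ
*-cancelˡ-≢0 a b a≢0 ab≡0 = begin
    b                       ≡⟨ QP.*-identityˡ b ⟨
    1ℚ * b                  ≡⟨ cong (_* b) (inv-l a a≢0) ⟨
    (inv a a≢0 * a) * b     ≡⟨ QP.*-assoc (inv a a≢0) a b ⟩
    inv a a≢0 * (a * b)     ≡⟨ cong (inv a a≢0 *_) ab≡0 ⟩
    inv a a≢0 * 0ℚ          ≡⟨ QP.*-zeroʳ (inv a a≢0) ⟩
    0ℚ                      ∎

ι-* : ∀ a b → ι a * ι b ≡ ι (a ℤ.* b)
ι-* a b = QP.toℚᵘ-injective (UP.≃-trans (QP.toℚᵘ-homo-* (ι a) (ι b))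
  (UP.≃-trans (UP.*-cong (QP.toℚᵘ-fromℚᵘ (U.mkℚᵘ a 0)) (QP.toℚᵘ-fromℚᵘ (U.mkℚᵘ b 0)))
    (UP.≃-sym (QP.toℚᵘ-fromℚᵘ (U.mkℚᵘ (a ℤ.* b) 0)))))

ι-den : ∀ q → ι (↧ q) * q ≡ ι (↥ q)
ι-den q@(Q.mkℚ n d-1 _) = QP.toℚᵘ-injective (UP.≃-trans (QP.toℚᵘ-homo-* (ι (↧ q)) q)
  (UP.≃-trans (UP.*-cong (QP.toℚᵘ-fromℚᵘ (U.mkℚᵘ (↧ q) 0)) (UP.≃-refl {U.mkℚᵘ n d-1}))
    (UP.≃-trans den*q≃num (UP.≃-sym (QP.toℚᵘ-fromℚᵘ (U.mkℚᵘ n 0))))))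
  where
  den*q≃num : (U.mkℚᵘ (↧ q) 0 U.* U.mkℚᵘ n d-1) U.≃ U.mkℚᵘ n 0
  den*q≃num = U.*≡* (trans (ℤP.*-identityʳ ((ℤ.+ suc d-1) ℤ.* n))
    (trans (ℤP.*-comm (ℤ.+ suc d-1) n) (cong (λ m → n ℤ.* ℤ.+ m) (sym (ℕP.*-identityˡ (suc d-1))))))

ι≢0 : ∀ z → ¬ z ≡ ℤ.0ℤ → ¬ ι z ≡ 0ℚ
ι≢0 z z≢0 ιz≡0 = z≢0 (begin
    z                                  ≡⟨ QP.↥-/ z 1 ⟨
    ↥ ι z ℤ.* ℤGCD.gcd z ℤ.1ℤ          ≡⟨ cong (λ q → ↥ q ℤ.* ℤGCD.gcd z ℤ.1ℤ) ιz≡0 ⟩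
    ℤ.0ℤ ℤ.* ℤGCD.gcd z ℤ.1ℤ           ≡⟨ ℤP.*-zeroˡ (ℤGCD.gcd z ℤ.1ℤ) ⟩
    ℤ.0ℤ                               ∎)

clearDenominators : ∀ {D} (x : Point D) →
  Σ ℤ λ N → ¬ N ≡ ℤ.0ℤ × Lattice (λ t → ι N * x t)
clearDenominators {zero} x = ℤ.1ℤ , (λ ()) , (λ ())
clearDenominators {suc D} x with clearDenominators (tail x)
... | N , N≢0 , Nx∈Λ = N ℤ.* ↧ x F.zero , N*den≢0 , integral
  where
  N*den≢0 : ¬ N ℤ.* ↧ x F.zero ≡ ℤ.0ℤ
  N*den≢0 eq with ℤP.i*j≡0⇒i≡0∨j≡0 N eq | x F.zero
  ... | inj₁ N≡0 | _ = N≢0 N≡0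
  ... | inj₂ () | Q.mkℚ _ _ _
  integral : Lattice (λ t → ι (N ℤ.* ↧ x F.zero) * x t)
  integral F.zero = N ℤ.* ↥ x F.zero , (begin
      ι (N ℤ.* ↧ x F.zero) * x F.zero      ≡⟨ cong (_* x F.zero) (ι-* N (↧ x F.zero)) ⟨
      (ι N * ι (↧ x F.zero)) * x F.zero    ≡⟨ QP.*-assoc (ι N) _ _ ⟩
      ι N * (ι (↧ x F.zero) * x F.zero)    ≡⟨ cong (ι N *_) (ι-den (x F.zero)) ⟩
      ι N * ι (↥ x F.zero)                 ≡⟨ ι-* N _ ⟩
      ι (N ℤ.* ↥ x F.zero)                 ∎)
  integral (F.suc t) = let (z , Nx≡z) = Nx∈Λ t in ↧ x F.zero ℤ.* z , (begin
      ι (N ℤ.* ↧ x F.zero) * x (F.suc t)   ≡⟨ cong (λ a → ι a * x (F.suc t)) (ℤP.*-comm N (↧ x F.zero)) ⟩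
      ι (↧ x F.zero ℤ.* N) * x (F.suc t)   ≡⟨ cong (_* x (F.suc t)) (ι-* (↧ x F.zero) N) ⟨
      (ι (↧ x F.zero) * ι N) * x (F.suc t) ≡⟨ QP.*-assoc (ι (↧ x F.zero)) (ι N) _ ⟩
      ι (↧ x F.zero) * (ι N * x (F.suc t)) ≡⟨ cong (ι (↧ x F.zero) *_) Nx≡z ⟩
      ι (↧ x F.zero) * ι z                 ≡⟨ ι-* (↧ x F.zero) z ⟩
      ι (↧ x F.zero ℤ.* z)                 ∎)

multiplier : ∀ {D} → Point D → ℚ
multiplier x = ι (proj₁ (clearDenominators x))

multiplier≢0 : ∀ {D} (x : Point D) → ¬ multiplier x ≡ 0ℚ
multiplier≢0 x = ι≢0 _ (proj₁ (proj₂ (clearDenominators x)))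

latticeMultiple : ∀ {D} → Point D → Point D
latticeMultiple x t = multiplier x * x t

latticeMultiple∈Λ : ∀ {D} (x : Point D) → Lattice (latticeMultiple x)
latticeMultiple∈Λ x = proj₂ (proj₂ (clearDenominators x))

LinIndep : ∀ {n D} → (Fin n → Point D) → Set
LinIndep {n} w = ∀ (c : Fin n → ℚ) → lincomb c w ≐ zeroPt → ∀ i → c i ≡ 0ℚ

Span : ∀ {r D} → (Fin r → Point D) → Point D → Set
Span {r} u x = Σ (Fin r → ℚ) λ c → x ≐ lincomb c u

span-basis : ∀ {r D} (u : Fin r → Point D) i → Span u (u i)
span-basis u i = unit i , λ t → sym (Σ-unit i (λ j → u j t))

span-trans : ∀ {r n D} {u : Fin r → Point D} {w : Fin n → Point D} →
  (∀ l → Span u (w l)) → ∀ {x} → Span w x → Span u x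
span-trans {u = u} {w} w∈u (c , x≐cw) =
  (λ i → Σℚ (λ l → c l * proj₁ (w∈u l) i)) , λ t →
  trans (x≐cw t) (trans (Σ-cong (λ l → cong (c l *_) (proj₂ (w∈u l) t)))
                        (lincomb-comp c (λ l → proj₁ (w∈u l)) u t))

span-scale : ∀ {r D} {u : Fin r → Point D} (s : ℚ) {x} → Span u x → Span u (λ t → s * x t)
span-scale {u = u} s (c , x≐cu) = (λ i → s * c i) , λ t → trans (cong (s *_) (x≐cu t))
  (trans (sym (Σ-*ˡ s (λ i → c i * u i t))) (Σ-cong (λ i → sym (QP.*-assoc s (c i) (u i t)))))

span-add : ∀ {r D} {u : Fin r → Point D} {x y} → Span u x → Span u y → Span u (λ t → x t + y t)
span-add {u = u} (c , x≐cu) (d , y≐du) = (λ i → c i + d i) ,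
  λ t → trans (cong₂ _+_ (x≐cu t) (y≐du t)) (sym (lincomb-+ c d u t))

span-sub : ∀ {r D} {u : Fin r → Point D} {x y} → Span u x → Span u y → Span u (λ t → x t - y t)
span-sub {u = u} (c , x≐cu) (d , y≐du) = (λ i → c i - d i) ,
  λ t → trans (cong₂ _-_ (x≐cu t) (y≐du t)) (sym (lincomb-- c d u t))

scaled-indep : ∀ {n D} (M : Fin n → ℚ) (w : Fin n → Point D) → (∀ i → ¬ M i ≡ 0ℚ) →
  LinIndep w → LinIndep (λ i t → M i * w i t)
scaled-indep M w M≢0 w-indep c cMw≐0 i = *-cancelˡ-≢0 (M i) (c i) (M≢0 i)
  (trans (QP.*-comm (M i) (c i)) (w-indep (λ j → c j * M j)
    (λ t → trans (Σ-cong (λ j → QP.*-assoc (c j) (M j) (w j t))) (cMw≐0 t)) i))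

lincomb-unit : ∀ {n} (c : Fin n → ℚ) j → lincomb c unit j ≡ c j
lincomb-unit c j = trans (Σ-cong (λ i → trans (cong (c i *_) (unit-sym i j)) (QP.*-comm (c i) (unit j i))))
  (Σ-unit j c)

-- Gaussian elimination on the first coordinate drives the two basic facts of
-- linear algebra over ℚ: too many vectors are dependent, and a vector outside a
-- span can be separated from it by a linear functional.

pivot? : ∀ {n m} (w : Fin n → Point (suc m)) →
  (∃ λ i → ¬ w i F.zero ≡ 0ℚ) ⊎ (∀ i → w i F.zero ≡ 0ℚ)
pivot? w with FP.any? (λ i → ¬? (w i F.zero QP.≟ 0ℚ))
... | yes pivot = inj₁ pivot
... | no ¬pivot = inj₂ (λ i → decidable-stable (w i F.zero QP.≟ 0ℚ) (λ w₀≢0 → ¬pivot (i , w₀≢0)))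

module Pivot {m : ℕ} (v : Point (suc m)) (v₀≢0 : ¬ v F.zero ≡ 0ℚ) where

  factor : Point (suc m) → ℚ
  factor x = x F.zero * inv (v F.zero) v₀≢0

  reduce : Point (suc m) → Point (suc m)
  reduce x t = x t - factor x * v t

  reduce-head : ∀ x → reduce x F.zero ≡ 0ℚ
  reduce-head x = begin
      x F.zero - (x F.zero * iv) * v F.zero   ≡⟨ cong (_-_ (x F.zero)) (QP.*-assoc (x F.zero) iv (v F.zero)) ⟩
      x F.zero - x F.zero * (iv * v F.zero)   ≡⟨ cong (λ a → x F.zero - x F.zero * a) (inv-l (v F.zero) v₀≢0) ⟩
      x F.zero - x F.zero * 1ℚ                ≡⟨ cong (_-_ (x F.zero)) (QP.*-identityʳ (x F.zero)) ⟩
      x F.zero - x F.zero                     ≡⟨ QP.+-inverseʳ (x F.zero) ⟩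
      0ℚ                                      ∎
    where iv = inv (v F.zero) v₀≢0

  reduce-inverse : ∀ x t → x t ≡ reduce x t + factor x * v t
  reduce-inverse x t = solve 3 (λ x f v → x := (x :- f :* v) :+ f :* v) refl (x t) (factor x) (v t)

  lincomb-reduce : ∀ {n} (μ : Fin n → ℚ) (w : Fin n → Point (suc m)) t →
    lincomb μ (λ j → reduce (w j)) t ≡ lincomb μ w t - Σℚ (λ j → μ j * factor (w j)) * v t
  lincomb-reduce μ w t = begin
      Σℚ (λ j → μ j * (w j t - factor (w j) * v t))
        ≡⟨ Σ-cong (λ j → solve 4 (λ m y r z → m :* (y :- r :* z) := m :* y :- (m :* r) :* z)
                                   refl (μ j) (w j t) (factor (w j)) (v t)) ⟩
      Σℚ (λ j → μ j * w j t - (μ j * factor (w j)) * v t)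
        ≡⟨ Σ-- (λ j → μ j * w j t) (λ j → (μ j * factor (w j)) * v t) ⟩
      lincomb μ w t - Σℚ (λ j → (μ j * factor (w j)) * v t)
        ≡⟨ cong (_-_ (lincomb μ w t)) (Σ-*ʳ (v t) (λ j → μ j * factor (w j))) ⟩
      lincomb μ w t - Σℚ (λ j → μ j * factor (w j)) * v t ∎

  dot-reduce : ∀ (g : Point m) x → g · tail (reduce x) ≡ g · tail x - factor x * (g · tail v)
  dot-reduce g x = begin
      Σℚ (λ i → g i * (x (F.suc i) - factor x * v (F.suc i)))
        ≡⟨ Σ-cong (λ i → solve 4 (λ g x s v → g :* (x :- s :* v) := g :* x :- s :* (g :* v))
                                   refl (g i) (x (F.suc i)) (factor x) (v (F.suc i))) ⟩
      Σℚ (λ i → g i * x (F.suc i) - factor x * (g i * v (F.suc i)))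
        ≡⟨ Σ-- (λ i → g i * x (F.suc i)) (λ i → factor x * (g i * v (F.suc i))) ⟩
      g · tail x - Σℚ (λ i → factor x * (g i * v (F.suc i)))
        ≡⟨ cong (_-_ (g · tail x)) (Σ-*ˡ (factor x) (λ i → g i * v (F.suc i))) ⟩
      g · tail x - factor x * (g · tail v) ∎

Dependent : ∀ {n D} → (Fin n → Point D) → Set
Dependent {n} w = Σ (Fin n → ℚ) λ c → lincomb c w ≐ zeroPt × ∃ λ i → ¬ c i ≡ 0ℚ

dependent-from-tail : ∀ {n m} (w : Fin n → Point (suc m)) → (∀ i → w i F.zero ≡ 0ℚ) →
  Dependent (λ i → tail (w i)) → Dependent w
dependent-from-tail w heads (c , c·w≐0 , nonzero) =
  c , (λ { F.zero → Σ-*-zeroʳ {f = c} heads ; (F.suc t) → c·w≐0 t }) , nonzero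

dependent-pivot : ∀ {n m} (w : Fin (suc n) → Point (suc m)) (i₀ : Fin (suc n))
  (nz : ¬ w i₀ F.zero ≡ 0ℚ) →
  Dependent (λ j → Pivot.reduce (w i₀) nz (w (punchIn i₀ j))) → Dependent w
dependent-pivot w i₀ nz (μ , μ·r≐0 , j₁ , μj₁≢0) =
  c , c·w≐0 , punchIn i₀ j₁ , (λ cj≡0 → μj₁≢0 (trans (sym (insertAt-punchIn μ i₀ (- R) j₁)) cj≡0))
  where
  open Pivot (w i₀) nz
  others : Fin _ → Point _
  others j = w (punchIn i₀ j)
  R : ℚ
  R = Σℚ (λ j → μ j * factor (others j))
  c : Fin _ → ℚ
  c = insertAt μ i₀ (- R)
  c·w≐0 : lincomb c w ≐ zeroPt
  c·w≐0 t = begin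
      lincomb c w t
        ≡⟨ Σ-punchIn i₀ (λ i → c i * w i t) ⟩
      c i₀ * w i₀ t + Σℚ (λ j → c (punchIn i₀ j) * others j t)
        ≡⟨ cong₂ _+_ (cong (_* w i₀ t) (insertAt-lookup μ i₀ (- R)))
                     (Σ-cong (λ j → cong (_* others j t) (insertAt-punchIn μ i₀ (- R) j))) ⟩
      (- R) * w i₀ t + lincomb μ others t
        ≡⟨ solve 3 (λ R v L → (:- R) :* v :+ L := L :- R :* v) refl R (w i₀ t) (lincomb μ others t) ⟩
      lincomb μ others t - R * w i₀ t
        ≡⟨ lincomb-reduce μ others t ⟨
      lincomb μ (λ j → reduce (others j)) t
        ≡⟨ μ·r≐0 t ⟩
      0ℚ ∎

dependent : ∀ m n → m < n → (w : Fin n → Point m) → Dependent w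
dependent zero (suc n) _ w = (λ _ → 1ℚ) , (λ ()) , F.zero , (λ ())
dependent (suc m) (suc n) (s≤s m<n) w with pivot? w
... | inj₂ heads =
  dependent-from-tail w heads (dependent m (suc n) (ℕP.m≤n⇒m≤1+n m<n) (λ i → tail (w i)))
... | inj₁ (i₀ , nz) = dependent-pivot w i₀ nz
  (dependent-from-tail _ (λ j → reduce-head (w (punchIn i₀ j)))
    (dependent m n m<n (λ j → tail (reduce (w (punchIn i₀ j))))))
  where open Pivot (w i₀) nz

Separates : ∀ {r D} → (Fin r → Point D) → Point D → Set
Separates u x = Σ (Point _) λ g → (∀ i → g · u i ≡ 0ℚ) × ¬ g · x ≡ 0ℚ

span-≐ : ∀ {r D} {u : Fin r → Point D} {x y} → x ≐ y → Span u y → Span u x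
span-≐ x≐y (c , y≐cu) = c , λ t → trans (x≐y t) (y≐cu t)

span-from-tail : ∀ {r m} (u : Fin r → Point (suc m)) (x : Point (suc m)) →
  x F.zero ≡ 0ℚ → (∀ i → u i F.zero ≡ 0ℚ) → Span (λ i → tail (u i)) (tail x) → Span u x
span-from-tail u x x₀≡0 heads (c , tail-x≐) =
  c , λ { F.zero → trans x₀≡0 (sym (Σ-*-zeroʳ {f = c} heads)) ; (F.suc t) → tail-x≐ t }

separate-from-tail : ∀ {r m} (u : Fin r → Point (suc m)) (x : Point (suc m)) →
  Separates (λ i → tail (u i)) (tail x) → Separates u x
separate-from-tail u x (g , g·u≡0 , g·x≢0) =
  (0ℚ ∷ g) , (λ i → trans (dot-head (u i)) (g·u≡0 i)) , (λ g·x≡0 → g·x≢0 (trans (sym (dot-head x)) g·x≡0))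
  where
  dot-head : ∀ y → (0ℚ ∷ g) · y ≡ g · tail y
  dot-head y = trans (cong (_+ g · tail y) (QP.*-zeroˡ (y F.zero))) (QP.+-identityˡ _)

separate-by-head : ∀ {r m} (u : Fin r → Point (suc m)) (x : Point (suc m)) →
  (∀ i → u i F.zero ≡ 0ℚ) → ¬ x F.zero ≡ 0ℚ → Separates u x
separate-by-head u x heads x₀≢0 =
  unit F.zero , (λ i → trans (Σ-unit F.zero (u i)) (heads i)) ,
  (λ g·x≡0 → x₀≢0 (trans (sym (Σ-unit F.zero x)) g·x≡0))

module PivotLift {m : ℕ} (v : Point (suc m)) (v₀≢0 : ¬ v F.zero ≡ 0ℚ) where
  open Pivot v v₀≢0

  lift-span : ∀ {r} (u : Fin r → Point (suc m)) (x : Point (suc m)) → Span u v →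
    Span (λ i → tail (reduce (u i))) (tail (reduce x)) → Span u x
  lift-span u x v∈u reduced-span = span-≐ x≐ (span-add (c , λ _ → refl) (span-scale (factor x - R) v∈u))
    where
    c = proj₁ (span-from-tail (λ i → reduce (u i)) (reduce x) (reduce-head x)
                 (λ i → reduce-head (u i)) reduced-span)
    reduce-x≐ = proj₂ (span-from-tail (λ i → reduce (u i)) (reduce x) (reduce-head x)
                 (λ i → reduce-head (u i)) reduced-span)
    R = Σℚ (λ i → c i * factor (u i))
    x≐ : x ≐ (λ t → lincomb c u t + (factor x - R) * v t)
    x≐ t = begin
        x t                                          ≡⟨ reduce-inverse x t ⟩
        reduce x t + factor x * v t                  ≡⟨ cong (_+ factor x * v t) (reduce-x≐ t) ⟩
        lincomb c (λ i → reduce (u i)) t + factor x * v t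
          ≡⟨ cong (_+ factor x * v t) (lincomb-reduce c u t) ⟩
        (lincomb c u t - R * v t) + factor x * v t
          ≡⟨ solve 4 (λ L R f v → (L :- R :* v) :+ f :* v := L :+ (f :- R) :* v) refl
                     (lincomb c u t) R (factor x) (v t) ⟩
        lincomb c u t + (factor x - R) * v t ∎

  lift-separate : ∀ {r} (u : Fin r → Point (suc m)) (x : Point (suc m)) →
    Separates (λ i → tail (reduce (u i))) (tail (reduce x)) → Separates u x
  lift-separate u x (g , g·u≡0 , g·x≢0) =
    g' , (λ i → trans (dot-g' (u i)) (g·u≡0 i)) , (λ g'·x≡0 → g·x≢0 (trans (sym (dot-g' x)) g'·x≡0))
    where
    G = g · tail v
    g' : Point (suc m)
    g' = ((- G) * inv (v F.zero) v₀≢0) ∷ g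
    dot-g' : ∀ y → g' · y ≡ g · tail (reduce y)
    dot-g' y = begin
        ((- G) * inv (v F.zero) v₀≢0) * y F.zero + g · tail y
          ≡⟨ solve 4 (λ G i y T → ((:- G) :* i) :* y :+ T := T :- (y :* i) :* G) refl
                     G (inv (v F.zero) v₀≢0) (y F.zero) (g · tail y) ⟩
        g · tail y - factor y * G ≡⟨ dot-reduce g y ⟨
        g · tail (reduce y) ∎

span-or-separate : ∀ {m r} (u : Fin r → Point m) (x : Point m) → Span u x ⊎ Separates u x
span-or-separate {zero} u x = inj₁ ((λ _ → 0ℚ) , λ ())
span-or-separate {suc m} u x with pivot? u
... | inj₁ (i₀ , nz) = Sum.map (lift-span u x (span-basis u i₀)) (lift-separate u x)
  (span-or-separate (λ i → tail (reduce (u i))) (tail (reduce x)))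
  where open Pivot (u i₀) nz
        open PivotLift (u i₀) nz
... | inj₂ heads with x F.zero QP.≟ 0ℚ
...   | no x₀≢0 = inj₂ (separate-by-head u x heads x₀≢0)
...   | yes x₀≡0 = Sum.map (span-from-tail u x x₀≡0 heads) (separate-from-tail u x)
  (span-or-separate (λ i → tail (u i)) (tail x))

steinitz : ∀ {n s D} (w : Fin n → Point D) (u : Fin s → Point D) →
  (∀ l → Span u (w l)) → LinIndep w → n ≤ s
steinitz {n} {s} w u w∈u w-indep with n ℕ.≤? s
... | yes n≤s = n≤s
... | no n≰s = ⊥-elim (c≢0 (w-indep c c·w≐0 i))
  where
  a = λ l → proj₁ (w∈u l)
  -- the coordinate vectors of w in ℚˢ are too many, hence dependent
  dependence = dependent s n (ℕP.≰⇒> n≰s) a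
  c = proj₁ dependence
  i = proj₁ (proj₂ (proj₂ dependence))
  c≢0 = proj₂ (proj₂ (proj₂ dependence))
  c·w≐0 : lincomb c w ≐ zeroPt
  c·w≐0 t = begin
      lincomb c w t                                 ≡⟨ Σ-cong (λ l → cong (c l *_) (proj₂ (w∈u l) t)) ⟩
      lincomb c (λ l → lincomb (a l) u) t           ≡⟨ lincomb-comp c a u t ⟩
      lincomb (λ i → Σℚ (λ l → c l * a l i)) u t    ≡⟨ Σ-*-zeroˡ (λ i → proj₁ (proj₂ dependence) i) ⟩
      0ℚ                                            ∎

cons-indep : ∀ {t D} (T : Fin t → Point D) (x : Point D) →
  Separates T x → LinIndep T → LinIndep (x ∷ T)
cons-indep T x (g , g·T≡0 , g·x≢0) T-indep c c·xT≐0 = λ { F.zero → c₀≡0 ; (F.suc j) → T-indep (λ j → c (F.suc j)) rest≐0 j }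
  where
  c₀≡0 : c F.zero ≡ 0ℚ
  c₀≡0 = *-cancelˡ-≢0 (g · x) (c F.zero) g·x≢0 (begin
      g · x * c F.zero                                 ≡⟨ QP.*-comm (g · x) (c F.zero) ⟩
      c F.zero * (g · x)                               ≡⟨ QP.+-identityʳ _ ⟨
      c F.zero * (g · x) + 0ℚ                          ≡⟨ cong (c F.zero * (g · x) +_) (Σ-*-zeroʳ {f = λ j → c (F.suc j)} g·T≡0) ⟨
      Σℚ (λ i → c i * (g · (x ∷ T) i))                 ≡⟨ dot-lincomb g c (x ∷ T) ⟨
      g · lincomb c (x ∷ T)                            ≡⟨ dot-zero g _ c·xT≐0 ⟩
      0ℚ                                               ∎)
  rest≐0 : lincomb (λ j → c (F.suc j)) T ≐ zeroPt
  rest≐0 t = begin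
      lincomb (λ j → c (F.suc j)) T t                  ≡⟨ QP.+-identityˡ _ ⟨
      0ℚ + lincomb (λ j → c (F.suc j)) T t
        ≡⟨ cong (_+ lincomb (λ j → c (F.suc j)) T t) (trans (cong (_* x t) c₀≡0) (QP.*-zeroˡ (x t))) ⟨
      lincomb c (x ∷ T) t                              ≡⟨ c·xT≐0 t ⟩
      0ℚ                                               ∎

record SpanningSubfamily {n D : ℕ} (K : Fin n → Point D) : Set where
  field
    size        : ℕ
    vectors     : Fin size → Point D
    independent : LinIndep vectors
    spans       : ∀ l → Span vectors (K l)
    from        : ∀ j → ∃ λ l → vectors j ≡ K l

-- greedy extraction: keep a vector of K exactly when it is not yet spanned
spanningSubfamily : ∀ {n D} (K : Fin n → Point D) → SpanningSubfamily K
spanningSubfamily {zero} K = record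
  { size = 0 ; vectors = λ () ; independent = λ _ _ () ; spans = λ () ; from = λ () }
spanningSubfamily {suc n} K with spanningSubfamily (tail K)
... | B with span-or-separate B.vectors (K F.zero)
  where module B = SpanningSubfamily B
...   | inj₁ K₀∈B = record
  { size = B.size ; vectors = B.vectors ; independent = B.independent
  ; spans = λ { F.zero → K₀∈B ; (F.suc l) → B.spans l }
  ; from = λ j → let (l , eq) = B.from j in F.suc l , eq }
  where module B = SpanningSubfamily B
...   | inj₂ K₀∉B = record
  { size = suc B.size
  ; vectors = K F.zero ∷ B.vectors
  ; independent = cons-indep B.vectors (K F.zero) K₀∉B B.independent
  ; spans = λ { F.zero → span-basis (K F.zero ∷ B.vectors) F.zero
              ; (F.suc l) → span-trans {u = K F.zero ∷ B.vectors} (λ j → span-basis (K F.zero ∷ B.vectors) (F.suc j)) (B.spans l) }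
  ; from = λ { F.zero → F.zero , refl ; (F.suc j) → let (l , eq) = B.from j in F.suc l , eq } }
  where module B = SpanningSubfamily B

prefix-indep : ∀ {a s D} (T : Fin (a ℕ.+ s) → Point D) → LinIndep T → LinIndep (λ i → T (i ↑ˡ s))
prefix-indep {a} {s} T T-indep c c·T≐0 i =
  trans (sym (lookup-++ˡ c zeros i)) (T-indep (c ++ zeros) padded≐0 (i ↑ˡ s))
  where
  zeros : Fin s → ℚ
  zeros _ = 0ℚ
  padded≐0 : lincomb (c ++ zeros) T ≐ zeroPt
  padded≐0 t = begin
      lincomb (c ++ zeros) T t
        ≡⟨ lincomb-split {a} {s} (c ++ zeros) T t ⟩
      lincomb (λ i → (c ++ zeros) (i ↑ˡ s)) (λ i → T (i ↑ˡ s)) t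
        + lincomb (λ j → (c ++ zeros) (a ↑ʳ j)) (λ j → T (a ↑ʳ j)) t
        ≡⟨ cong₂ _+_ (trans (Σ-cong (λ i → cong (_* T (i ↑ˡ s) t) (lookup-++ˡ c zeros i))) (c·T≐0 t))
                     (Σ-*-zeroˡ (λ j → lookup-++ʳ c zeros j)) ⟩
      0ℚ + 0ℚ ≡⟨ QP.+-identityʳ 0ℚ ⟩
      0ℚ ∎

fewer-indep : ∀ {a t D} (P : Point D → Set) → a ≤ t → (T : Fin t → Point D) → LinIndep T →
  (∀ j → P (T j)) → Σ (Fin a → Point D) λ T' → LinIndep T' × (∀ j → P (T' j))
fewer-indep P a≤t T T-indep T∈P with ℕP.m≤n⇒∃[o]m+o≡n a≤t
... | s , refl = (λ i → T (i ↑ˡ s)) , prefix-indep T T-indep , (λ j → T∈P (j ↑ˡ s))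

edges : ∀ {n D} → (Fin (suc n) → Point D) → Fin n → Point D
edges p l t = p (F.suc l) t - p F.zero t

-- coefficients c on the edges are the coefficients (−Σc) ∷ c, of sum 0, on the points
balance : ∀ {n} → (Fin n → ℚ) → Fin (suc n) → ℚ
balance c = (- Σℚ c) ∷ c

balance-Σ : ∀ {n} (c : Fin n → ℚ) → Σℚ (balance c) ≡ 0ℚ
balance-Σ c = QP.+-inverseˡ (Σℚ c)

lincomb-balance : ∀ {n D} (c : Fin n → ℚ) (p : Fin (suc n) → Point D) t →
  lincomb (balance c) p t ≡ lincomb c (edges p) t
lincomb-balance c p t = begin
    (- Σℚ c) * p F.zero t + Σℚ (λ l → c l * p (F.suc l) t)
      ≡⟨ solve 3 (λ S z Y → (:- S) :* z :+ Y := Y :- S :* z) refl (Σℚ c) (p F.zero t) _ ⟩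
    Σℚ (λ l → c l * p (F.suc l) t) - Σℚ c * p F.zero t
      ≡⟨ cong (_-_ (Σℚ (λ l → c l * p (F.suc l) t))) (Σ-*ʳ (p F.zero t) c) ⟨
    Σℚ (λ l → c l * p (F.suc l) t) - Σℚ (λ l → c l * p F.zero t)
      ≡⟨ Σ-- (λ l → c l * p (F.suc l) t) (λ l → c l * p F.zero t) ⟨
    Σℚ (λ l → c l * p (F.suc l) t - c l * p F.zero t)
      ≡⟨ Σ-cong (λ l → solve 3 (λ c a b → c :* a :- c :* b := c :* (a :- b)) refl
                               (c l) (p (F.suc l) t) (p F.zero t)) ⟩
    lincomb c (edges p) t ∎

balance-tail : ∀ {n} (κ : Fin (suc n) → ℚ) → Σℚ κ ≡ 0ℚ → ∀ i → κ i ≡ balance (tail κ) i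
balance-tail κ Σκ≡0 F.zero = begin
    κ F.zero                                    ≡⟨ solve 2 (λ a s → a := (a :+ s) :- s) refl (κ F.zero) (Σℚ (tail κ)) ⟩
    (κ F.zero + Σℚ (tail κ)) - Σℚ (tail κ)      ≡⟨ cong (_- Σℚ (tail κ)) Σκ≡0 ⟩
    0ℚ - Σℚ (tail κ)                            ≡⟨ QP.+-identityˡ _ ⟩
    - Σℚ (tail κ)                               ∎
balance-tail κ Σκ≡0 (F.suc i) = refl

affIndep⇒edges-indep : ∀ {n D} (p : Fin (suc n) → Point D) → AffIndep p → LinIndep (edges p)
affIndep⇒edges-indep p p-indep c c·edges≐0 l =
  p-indep (balance c) (balance-Σ c) (λ t → trans (lincomb-balance c p t) (c·edges≐0 t)) (F.suc l)

affIndep-with-origin : ∀ {n D} (w : Fin n → Point D) → LinIndep w → AffIndep (zeroPt ∷ w)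
affIndep-with-origin w w-indep λs Σλs≡0 λs·0w≐0 = λ { F.zero → λ₀≡0 ; (F.suc i) → tail≡0 i }
  where
  tail≡0 : ∀ i → λs (F.suc i) ≡ 0ℚ
  tail≡0 = w-indep (tail λs) (λ t → trans
    (sym (trans (cong (_+ lincomb (tail λs) w t) (QP.*-zeroʳ (λs F.zero))) (QP.+-identityˡ _)))
    (λs·0w≐0 t))
  λ₀≡0 : λs F.zero ≡ 0ℚ
  λ₀≡0 = trans (sym (QP.+-identityʳ (λs F.zero))) (trans (cong (λs F.zero +_) (sym (Σ-zero tail≡0))) Σλs≡0)

affIndep-bound : ∀ {k} (q : Fin (suc (suc k)) → Point k) → ¬ AffIndep q
affIndep-bound {k} q q-indep =
  let (c , c·edges≐0 , i , cᵢ≢0) = dependent k (suc k) ℕP.≤-refl (edges q)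
  in cᵢ≢0 (affIndep⇒edges-indep q q-indep c c·edges≐0 i)

-- homogenisation x ↦ (1, x) turns affine independence into linear independence
hom : ∀ {D} → Point D → Point (suc D)
hom x = 1ℚ ∷ x

Σ-*-one : ∀ {n} (c : Fin n → ℚ) → Σℚ (λ i → c i * 1ℚ) ≡ Σℚ c
Σ-*-one c = Σ-cong (λ i → QP.*-identityʳ (c i))

affIndep⇒hom-indep : ∀ {n D} (q : Fin n → Point D) → AffIndep q → LinIndep (λ i → hom (q i))
affIndep⇒hom-indep q q-indep c c·hq≐0 =
  q-indep c (trans (sym (Σ-*-one c)) (c·hq≐0 F.zero)) (λ t → c·hq≐0 (F.suc t))

hom-indep⇒affIndep : ∀ {n D} (q : Fin n → Point D) → LinIndep (λ i → hom (q i)) → AffIndep q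
hom-indep⇒affIndep q hq-indep λs Σλs≡0 λs·q≐0 =
  hq-indep λs (λ { F.zero → trans (Σ-*-one λs) Σλs≡0 ; (F.suc t) → λs·q≐0 t })

indep-≗ : ∀ {n D} {w w' : Fin n → Point D} → (∀ i → w i ≡ w' i) → LinIndep w → LinIndep w'
indep-≗ w≡w' w-indep c c·w'≐0 = w-indep c (λ t → trans (Σ-cong (λ i → cong (λ x → c i * x t) (w≡w' i))) (c·w'≐0 t))

extend-affIndep : ∀ {n D} (p : Fin n → Point D) (a : Point D) →
  Separates (λ i → hom (p i)) (hom a) → AffIndep p → AffIndep (a ∷ p)
extend-affIndep p a separated p-indep = hom-indep⇒affIndep (a ∷ p)
  (indep-≗ {w = hom a ∷ (λ i → hom (p i))} {w' = λ i → hom ((a ∷ p) i)}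
     (λ { F.zero → refl ; (F.suc i) → refl })
    (cons-indep (λ i → hom (p i)) (hom a) separated (affIndep⇒hom-indep p p-indep)))

AffComb : ∀ {n D} → (Fin n → Point D) → Point D → Set
AffComb {n} p x = Σ (Fin n → ℚ) λ μ → Σℚ μ ≡ 1ℚ × x ≐ lincomb μ p

affComb⇒aff : ∀ {n D} {A : PSet D} (p : Fin n → Point D) → AllIn A p → ∀ {x} → AffComb p x → aff A x
affComb⇒aff {n} p p∈A (μ , Σμ≡1 , x≐μp) = n , p , μ , p∈A , Σμ≡1 , x≐μp

aff-mono : ∀ {D} {A B : PSet D} → (∀ x → A x → B x) → ∀ x → aff A x → aff B x
aff-mono A⊆B x (n , as , λs , as∈A , Σλs≡1 , x≐) = n , as , λs , (λ j → A⊆B (as j) (as∈A j)) , Σλs≡1 , x≐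

affComb-trans : ∀ {n s D} (p : Fin s → Point D) (as : Fin n → Point D) → (∀ j → AffComb p (as j)) →
  ∀ {x} → AffComb as x → AffComb p x
affComb-trans p as as∈p (λs , Σλs≡1 , x≐) = κ , Σκ≡1 , λ t → trans (x≐ t)
  (trans (Σ-cong (λ j → cong (λs j *_) (proj₂ (proj₂ (as∈p j)) t))) (lincomb-comp λs μ p t))
  where
  μ = λ j → proj₁ (as∈p j)
  κ = λ i → Σℚ (λ j → λs j * μ j i)
  Σκ≡1 : Σℚ κ ≡ 1ℚ
  Σκ≡1 = begin
      Σℚ (λ i → Σℚ (λ j → λs j * μ j i))  ≡⟨ Σ-swap (λ j i → λs j * μ j i) ⟨
      Σℚ (λ j → Σℚ (λ i → λs j * μ j i))
        ≡⟨ Σ-cong (λ j → trans (Σ-*ˡ (λs j) (μ j))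
                    (trans (cong (λs j *_) (proj₁ (proj₂ (as∈p j)))) (QP.*-identityʳ (λs j)))) ⟩
      Σℚ λs                                ≡⟨ Σλs≡1 ⟩
      1ℚ                                   ∎

module OriginIn {d D : ℕ} (p : Fin (suc d) → Point D) (origin : AffComb p zeroPt) where

  ν = proj₁ origin

  affComb⇒span : ∀ {x} → AffComb p x → Span (edges p) x
  affComb⇒span {x} (μ , Σμ≡1 , x≐μp) = tail κ , x≐
    where
    κ = λ i → μ i - ν i
    Σκ≡0 : Σℚ κ ≡ 0ℚ
    Σκ≡0 = trans (Σ-- μ ν) (trans (cong₂ _-_ Σμ≡1 (proj₁ (proj₂ origin))) (QP.+-inverseʳ 1ℚ))
    x≐ : x ≐ lincomb (tail κ) (edges p)
    x≐ t = begin
        x t                                   ≡⟨ QP.+-identityʳ (x t) ⟨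
        x t - 0ℚ                              ≡⟨ cong₂ _-_ (x≐μp t) (proj₂ (proj₂ origin) t) ⟩
        lincomb μ p t - lincomb ν p t         ≡⟨ lincomb-- μ ν p t ⟨
        lincomb κ p t                         ≡⟨ Σ-cong (λ i → cong (_* p i t) (balance-tail κ Σκ≡0 i)) ⟩
        lincomb (balance (tail κ)) p t        ≡⟨ lincomb-balance (tail κ) p t ⟩
        lincomb (tail κ) (edges p) t          ∎

  span⇒affComb : ∀ {x} → Span (edges p) x → AffComb p x
  span⇒affComb {x} (c , x≐) = μ , Σμ≡1 , λ t → begin
      x t                                              ≡⟨ x≐ t ⟩
      lincomb c (edges p) t                            ≡⟨ lincomb-balance c p t ⟨
      lincomb (balance c) p t                          ≡⟨ QP.+-identityʳ _ ⟨
      lincomb (balance c) p t + 0ℚ                     ≡⟨ cong (lincomb (balance c) p t +_) (proj₂ (proj₂ origin) t) ⟩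
      lincomb (balance c) p t + lincomb ν p t          ≡⟨ lincomb-+ (balance c) ν p t ⟨
      lincomb μ p t                                    ∎
    where
    μ = λ i → balance c i + ν i
    Σμ≡1 : Σℚ μ ≡ 1ℚ
    Σμ≡1 = trans (Σ-+ (balance c) ν) (trans (cong₂ _+_ (balance-Σ c) (proj₁ (proj₂ origin))) (QP.+-identityˡ 1ℚ))

-- For a maximal affinely independent family p in A, every point of A is an
-- affine combination of p: otherwise its homogenisation could be separated
-- from those of p, and it would extend p.
point-affComb : ∀ {D d} (A : PSet D) (p : Fin (suc d) → Point D) → AllIn A p → AffIndep p →
  (∀ (q : Fin (suc (suc d)) → Point D) → AllIn A q → ¬ AffIndep q) →
  ∀ a → A a → AffComb p a
point-affComb A p p∈A p-indep maximal a a∈A =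
  Sum.[ from-span , (λ separated → ⊥-elim (maximal (a ∷ p) a∷p∈A (extend-affIndep p a separated p-indep))) ]′
    (span-or-separate (λ i → hom (p i)) (hom a))
  where
  from-span : Span (λ i → hom (p i)) (hom a) → AffComb p a
  from-span (μ , ha≐μhp) = μ , trans (sym (Σ-*-one μ)) (sym (ha≐μhp F.zero)) , (λ t → ha≐μhp (F.suc t))
  a∷p∈A : AllIn A (a ∷ p)
  a∷p∈A F.zero = a∈A
  a∷p∈A (F.suc i) = p∈A i

aff⇒affComb : ∀ {D d} (A : PSet D) (p : Fin (suc d) → Point D) → AllIn A p → AffIndep p →
  (∀ (q : Fin (suc (suc d)) → Point D) → AllIn A q → ¬ AffIndep q) →
  ∀ {x} → aff A x → AffComb p x
aff⇒affComb A p p∈A p-indep maximal (n , as , λs , as∈A , Σλs≡1 , x≐) =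
  affComb-trans p as (λ j → point-affComb A p p∈A p-indep maximal (as j) (as∈A j)) (λs , Σλs≡1 , x≐)

rank-from-bounds : ∀ {D r} (S : PSet D) → S zeroPt → (w : Fin r → Point D) → AllIn S w → LinIndep w →
  (∀ (q : Fin (suc (suc r)) → Point D) → AllIn S q → ¬ AffIndep q) → Rank S r
rank-from-bounds S 0∈S w w∈S w-indep upper =
  ((zeroPt ∷ w) , (λ { F.zero → 0∈S ; (F.suc i) → w∈S i }) , affIndep-with-origin w w-indep) , upper

module ProjectionRanks {D d k : ℕ} (k≤D : k ≤ D) (L : PSet D)
  (b : Fin d → Point D) (b-indep : LinIndep b)
  (L⇒span : ∀ {x} → L x → Span b x) (span⇒L : ∀ {x} → Span b x → L x)
  (y : Fin k → Point D) (y∈L : ∀ i → L (y i)) (y-proj : ∀ i → proj k k≤D (y i) ≐ unit i) where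

  π : Point D → Point k
  π = proj k k≤D

  Vanishing : Point D → Set
  Vanishing x = π x ≐ zeroPt

  π-lincomb-y : ∀ (c : Fin k → ℚ) j → π (lincomb c y) j ≡ c j
  π-lincomb-y c j = trans (Σ-cong (λ i → cong (c i *_) (y-proj i j))) (lincomb-unit c j)

  π-y-indep : LinIndep (λ i → π (y i))
  π-y-indep c c·πy≐0 j = trans (sym (π-lincomb-y c j)) (c·πy≐0 j)

  y∈span : ∀ i → Span b (y i)
  y∈span i = L⇒span (y∈L i)

  0∈L : L zeroPt
  0∈L = span⇒L ((λ _ → 0ℚ) , λ t → sym (Σ-*-zeroˡ {g = λ l → b l t} (λ _ → refl)))

  append-y-indep : ∀ {a} (r : Fin a → Point D) → LinIndep r → (∀ i → Vanishing (r i)) → LinIndep (r ++ y)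
  append-y-indep {a} r r-indep r-vanish c c·ry≐0 =
    λ x → subst (λ x → c x ≡ 0ℚ) (FP.join-splitAt a k x) (by-block (splitAt a x))
    where
    cr = λ i → c (i ↑ˡ k)
    cy = λ j → c (a ↑ʳ j)
    split≐0 : ∀ t → lincomb cr r t + lincomb cy y t ≡ 0ℚ
    split≐0 t = trans (sym (lincomb-++ c r y t)) (c·ry≐0 t)
    cy≡0 : ∀ j → cy j ≡ 0ℚ
    cy≡0 j = begin
        cy j                                  ≡⟨ π-lincomb-y cy j ⟨
        lincomb cy y (inject≤ j k≤D)          ≡⟨ QP.+-identityˡ _ ⟨
        0ℚ + lincomb cy y (inject≤ j k≤D)     ≡⟨ cong (_+ lincomb cy y (inject≤ j k≤D)) (Σ-*-zeroʳ {f = cr} (λ i → r-vanish i j)) ⟨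
        lincomb cr r (inject≤ j k≤D) + lincomb cy y (inject≤ j k≤D) ≡⟨ split≐0 (inject≤ j k≤D) ⟩
        0ℚ                                    ∎
    cr≡0 : ∀ i → cr i ≡ 0ℚ
    cr≡0 = r-indep cr (λ t → trans (sym (QP.+-identityʳ _))
      (trans (cong (lincomb cr r t +_) (sym (Σ-*-zeroˡ cy≡0))) (split≐0 t)))
    by-block : ∀ s → c (join a k s) ≡ 0ℚ
    by-block (inj₁ i) = cr≡0 i
    by-block (inj₂ j) = cy≡0 j

  residual : Point D → Point D
  residual x t = x t - lincomb (π x) y t

  residual-vanishes : ∀ x → Vanishing (residual x)
  residual-vanishes x j = trans (cong (_-_ (x (inject≤ j k≤D))) (π-lincomb-y (π x) j)) (QP.+-inverseʳ (x (inject≤ j k≤D)))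

  residual∈span : ∀ {x} → Span b x → Span b (residual x)
  residual∈span {x} x∈b = span-sub x∈b (span-trans y∈span (π x , λ _ → refl))

  vanishing-lower : Σ (Fin (d ∸ k) → Point D) λ T → LinIndep T × (∀ j → Span b (T j) × Vanishing (T j))
  vanishing-lower = fewer-indep (λ x → Span b x × Vanishing x) d∸k≤size B.vectors B.independent B-good
    where
    B = spanningSubfamily (λ l → residual (b l))
    module B = SpanningSubfamily B
    B-good : ∀ j → Span b (B.vectors j) × Vanishing (B.vectors j)
    B-good j = let (l , eq) = B.from j in
      subst (λ x → Span b x × Vanishing x) (sym eq) (residual∈span (span-basis b l) , residual-vanishes (b l))
    -- b l = residual (b l) + Σᵢ (b l)ᵢ yᵢ lies in the span of B ++ y
    b∈By : ∀ l → Span (B.vectors ++ y) (b l)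
    b∈By l = span-≐ (λ t → solve 2 (λ x s → x := (x :- s) :+ s) refl (b l t) (lincomb (π (b l)) y t))
      (span-add (span-trans (λ j → subst (Span (B.vectors ++ y)) (lookup-++ˡ B.vectors y j)
                                          (span-basis (B.vectors ++ y) (j ↑ˡ k))) (B.spans l))
                (span-trans (λ i → subst (Span (B.vectors ++ y)) (lookup-++ʳ B.vectors y i)
                                          (span-basis (B.vectors ++ y) (B.size ↑ʳ i))) (π (b l) , λ _ → refl)))
    d∸k≤size : d ∸ k ≤ B.size
    d∸k≤size = ℕP.m≤n+o⇒m∸n≤o d k
      (subst (d ≤_) (ℕP.+-comm B.size k) (steinitz b (B.vectors ++ y) b∈By b-indep))

  y-indep : LinIndep y
  y-indep c c·y≐0 j = trans (sym (π-lincomb-y c j)) (c·y≐0 (inject≤ j k≤D))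

  k≤d : k ≤ d
  k≤d = steinitz y b y∈span y-indep

  -- L ∩ {first k coordinates vanish} has no d - k + 1 independent vectors:
  -- together with y they would give d + 1 independent vectors in span b
  vanishing-upper : ∀ (r : Fin (suc (d ∸ k)) → Point D) → LinIndep r →
    (∀ i → Span b (r i) × Vanishing (r i)) → ⊥
  vanishing-upper r r-indep r-good = ℕP.<⇒≱ too-many ℕP.≤-refl
    where
    too-many : d < d
    too-many = subst (λ m → suc m ≤ d) (ℕP.m∸n+n≡m k≤d)
      (steinitz (r ++ y) b (all-++ (Span b) r y (λ i → proj₁ (r-good i)) y∈span)
                (append-y-indep r r-indep (λ i → proj₂ (r-good i))))

  lattice-0 : Lattice {D} zeroPt
  lattice-0 _ = ℤ.0ℤ , refl

  -- part (ii), first claim: π(L ∩ Λ) has rank k, witnessed by lattice multiples of y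
  rank-projection : Rank (Img π (L ∩ Lattice)) k
  rank-projection = rank-from-bounds (Img π (L ∩ Lattice)) (zeroPt , (0∈L , lattice-0) , λ _ → refl)
    (λ i → π (z i)) (λ i → z i , (z∈L i , latticeMultiple∈Λ (y i)) , λ _ → refl)
    (scaled-indep (λ i → multiplier (y i)) (λ i → π (y i)) (λ i → multiplier≢0 (y i)) π-y-indep)
    (λ q _ → affIndep-bound q)
    where
    z : Fin k → Point D
    z i = latticeMultiple (y i)
    z∈L : ∀ i → L (z i)
    z∈L i = span⇒L (span-scale (multiplier (y i)) (y∈span i))

  rank-vanishing : Rank (UpperLattice k k≤D ∩ (L ∩ Lattice)) (d ∸ k)
  rank-vanishing = rank-from-bounds S ((lattice-0 , λ _ → refl) , (0∈L , lattice-0)) W W∈S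
    (scaled-indep (λ j → multiplier (T j)) T (λ j → multiplier≢0 (T j)) T-indep) upper
    where
    S = UpperLattice k k≤D ∩ (L ∩ Lattice)
    T = proj₁ vanishing-lower
    T-indep = proj₁ (proj₂ vanishing-lower)
    T-good = proj₂ (proj₂ vanishing-lower)
    W : Fin (d ∸ k) → Point D
    W j = latticeMultiple (T j)
    W∈S : AllIn S W
    W∈S j = (latticeMultiple∈Λ (T j) ,
             λ i → trans (cong (multiplier (T j) *_) (proj₂ (T-good j) i)) (QP.*-zeroʳ (multiplier (T j)))) ,
            (span⇒L (span-scale (multiplier (T j)) (proj₁ (T-good j))) , latticeMultiple∈Λ (T j))
    upper : ∀ (q : Fin (suc (suc (d ∸ k))) → Point D) → AllIn S q → ¬ AffIndep q
    upper q q∈S q-indep = vanishing-upper (edges q) (affIndep⇒edges-indep q q-indep) λ i →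
      span-sub (L⇒span (proj₁ (proj₂ (q∈S (F.suc i))))) (L⇒span (proj₁ (proj₂ (q∈S F.zero)))) ,
      λ j → trans (cong₂ _-_ (proj₂ (proj₁ (q∈S (F.suc i))) j) (proj₂ (proj₁ (q∈S F.zero)) j))
                  (QP.+-inverseʳ 0ℚ)

projected-lattice : ∀ {D k} (k≤D : k ≤ D) {U W : PSet D} → (∀ x → U x → W x) →
  Integral k k≤D U → Img (proj k k≤D) (W ∩ Lattice) ≋ Lattice
projected-lattice k≤D {W = W} U⊆W (_ , Λₖ⊆πU) = πW⊆Λₖ , Λₖ⊆πW
  where
  πW⊆Λₖ : ∀ y → Img (proj _ k≤D) (W ∩ Lattice) y → Lattice y
  πW⊆Λₖ y (x , (_ , x∈Λ) , πx≐y) i = let (z , xᵢ≡z) = x∈Λ (inject≤ i k≤D) in z , trans (sym (πx≐y i)) xᵢ≡z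
  Λₖ⊆πW : ∀ y → Lattice y → Img (proj _ k≤D) (W ∩ Lattice) y
  Λₖ⊆πW y y∈Λ = let (x , (x∈U , x∈Λ) , πx≐y) = Λₖ⊆πU y y∈Λ in x , (U⊆W x x∈U , x∈Λ) , πx≐y

face⊆ : ∀ {D} {P F : PSet D} → IsFace P F → ∀ x → F x → P x
face⊆ (_ , _ , _ , F⊆ , _) x x∈F = proj₁ (F⊆ x x∈F)

central-ranks : ∀ {D d k} (k≤D : k ≤ D) (P : PSet D) → AffDim P d → Central P →
  (U : PSet D) → (∀ x → U x → aff P x) → GenPos k k≤D U →
  Rank (Img (proj k k≤D) (aff P ∩ Lattice)) k × Rank (UpperLattice k k≤D ∩ (aff P ∩ Lattice)) (d ∸ k)
central-ranks k≤D P ((p , p∈P , p-indep) , maximal) central U U⊆affP U-genpos =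
  R.rank-projection , R.rank-vanishing
  where
  aff⇒comb : ∀ {x} → aff P x → AffComb p x
  aff⇒comb = aff⇒affComb P p p∈P p-indep maximal
  open OriginIn p (aff⇒comb central)
  y∈U = λ i → U-genpos (unit i)
  module R = ProjectionRanks k≤D (aff P) (edges p) (affIndep⇒edges-indep p p-indep)
    (λ x∈P → affComb⇒span (aff⇒comb x∈P)) (λ x∈b → affComb⇒aff {A = P} p p∈P (span⇒affComb x∈b))
    (λ i → proj₁ (y∈U i)) (λ i → U⊆affP _ (proj₁ (proj₂ (y∈U i)))) (λ i → proj₂ (proj₂ (y∈U i)))

lemma3p11 : ∀ {D m : ℕ} (v : Fin (suc m) → Point D) (d k : ℕ)
  → AffDim (conv v) d → k ≤ d → (k≤D : k ≤ D)
  → ((Σ (PSet D) λ F → IsFace (conv v) F × AffDim F k × Integral k k≤D (aff F))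
      → Img (proj k k≤D) (aff (conv v) ∩ Lattice) ≋ Lattice)
  × (Central (conv v)
      → (Σ (PSet D) λ F → IsFace (conv v) F × AffDim F k × GenPos k k≤D (aff F))
      → Rank (Img (proj k k≤D) (aff (conv v) ∩ Lattice)) k
        × Rank (UpperLattice k k≤D ∩ (aff (conv v) ∩ Lattice)) (d ∸ k))
lemma3p11 v d k P-dim _ k≤D =
  (λ { (F , F-face , _ , F-integral) →
         projected-lattice k≤D (aff-mono (face⊆ F-face)) F-integral }) ,
  (λ { central (F , F-face , _ , F-genpos) →
         central-ranks k≤D (conv v) P-dim central (aff F) (aff-mono (face⊆ F-face)) F-genpos })
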